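{- Let $\Pi X.\,s\,[\exists\vec{x}.\varphi]$ be a satisfiable existentially constrained term and let $\rho$ be a left-linear constrained rewrite rule with $\mathrm{Var}(\rho)\cap\mathrm{Var}(s,\varphi)=\emptyset$. If $\Pi X.s[\exists\vec{x}.\varphi]\to_\rho\Pi Y.t[\exists\vec{y}.\psi]$, then $\mathrm{FVar}(\exists\vec{y}.\psi)\subseteq\mathrm{ExVar}(\rho)\cup(X\cap\mathrm{Var}(t))$.
   Context: Fix a many-sorted signature whose sorts are partitioned into theory sorts and term sorts and whose function symbols are partitioned into theory symbols (all argument and result sorts are theory sorts) and term symbols; there is a theory sort $\mathsf{Bool}$. $\mathrm{Var}(t_1,\dots,t_n)$ is the set of variables in the $t_i$; $\mathrm{Pos}(s)$, $s|_p$, $s[u]_p$ as usual. A fixed model $\mathcal{M}$ interprets theory sorts by nonempty sets and theory symbols by functions, with $\mathsf{Bool}=\{\mathsf{true},\mathsf{false}\}$ and standard connectives and equalities; every element of every interpreted sort is a constant theory symbol, called a value; $\mathrm{Val}$ is the set of values. A logical constraint is a $\mathsf{Bool}$-sorted term of theory symbols and variables; $\models_{\mathcal{M},\xi}\varphi$ (valuation $\xi$) and $\models_{\mathcal{M}}\varphi$ (all valuations) as usual. Substitutions are sort-preserving, $\mathrm{Dom}(\sigma)=\{x\mid\sigma(x)\ne x\}$. Existential constraint $\exists\vec x.\varphi$: $\{\vec x\}\subseteq\mathrm{Var}(\varphi)$, $\mathrm{FVar}(\exists\vec x.\varphi)=\mathrm{Var}(\varphi)\setminus\{\vec x\}$,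 $\mathrm{BVar}(\exists\vec x.\varphi)=\{\vec x\}$; $\models_{\mathcal{M},\xi}\exists\vec x.\varphi$ iff some values $\vec v$ give $\models_{\mathcal{M},\xi}\varphi\{\vec x\mapsto\vec v\}$; valid/satisfiable: for all/some $\xi$. An existentially constrained term $\Pi X.s[\exists\vec x.\varphi]$ requires $\mathrm{FVar}(\exists\vec x.\varphi)\subseteq X\subseteq\mathrm{Var}(s)$ and $\{\vec x\}\cap\mathrm{Var}(s)=\emptyset$; satisfiable if its constraint is. A constrained rewrite rule $\rho:\Pi Z.\ell\to r[\pi]$: $\ell,r$ terms of the same sort, $\pi$ a logical constraint, $(\mathrm{Var}(r)\setminus\mathrm{Var}(\ell))\cup\mathrm{Var}(\pi)\subseteq Z\subseteq\mathrm{Var}(\ell,r,\pi)=\mathrm{Var}(\rho)$; left-linear if $\ell$ is linear; $\mathrm{ExVar}(\rho)=\mathrm{Var}(r)\setminus\mathrm{Var}(\ell)$. Most general rewrite step: for satisfiable $\Pi X.s[\exists\vec x.\varphi]$ and left-linear $\rho$ with $\mathrm{Var}(\rho)\cap\mathrm{Var}(s,\varphi)=\emptyset$, if $p\in\mathrm{Pos}(s)$ and $\gamma$ satisfy $\mathrm{Dom}(\gamma)=\mathrm{Var}(\ell)$, $s|_p=\ell\gamma$, $\gamma(x)\in\mathrm{Val}\cup X$ for all $x\in\mathrm{Var}(\ell)\cap Z$, and $\models_{\mathcal{M}}(\exists\vec x.\varphi)\Rightarrow(\exists\vec z.\pi\gamma)$ with $\{\vec z\}=\mathrm{Var}(\pi)\setminus\mathrm{Var}(\ell)$,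 then $\Pi X.s[\exists\vec x.\varphi]\to_\rho\Pi Y.t[\exists\vec y.\psi]$ with $t=s[r\gamma]_p$, $\psi=\varphi\land\pi\gamma$, $\{\vec y\}=\mathrm{Var}(\psi)\setminus\mathrm{Var}(t)$, $Y=\mathrm{ExVar}(\rho)\cup(X\cap\mathrm{Var}(t))$. -}

module Defs where

open import Data.Bool using (Bool; true; false; T; _∧_; if_then_else_)
open import Data.Unit using (⊤; tt)
open import Data.Nat using (ℕ; zero; suc; _≤_; _+_)
open import Data.List using (List; []; _∷_)
open import Data.List.Membership.Propositional using (_∈_)
open import Data.List.Relation.Unary.All using (All; []; _∷_)
open import Data.Maybe using (Maybe; just; nothing; _>>=_)
import Data.Maybe as Maybe
open import Data.Product using (Σ; _×_; _,_; ∃-syntax)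
open import Data.Sum using (_⊎_)
open import Relation.Nullary using (¬_; does; yes; no)
open import Relation.Binary.Definitions using (DecidableEquality)
open import Relation.Binary.PropositionalEquality using (_≡_; _≢_; refl; subst)
open import Relation.Unary using (Pred)
open import Function.Bundles using (_⇔_)
open import Level using (0ℓ)

-- Many-sorted signature, partitioned into theory / term sorts and
-- theory / term symbols, with a theory sort Bool (and the connective ∧,
-- needed to form ψ = φ ∧ πγ), and a sorted set of variables.

record Signature : Set₁ where
  field
    Sort      : Set
    _≟S_      : DecidableEquality Sort
    isThSort  : Sort → Bool
    Fun       : List Sort → Sort → Set
    isThFun   : ∀ {ss σ} → Fun ss σ → Bool
    thFunSorts : ∀ {ss σ} (f : Fun ss σ) → T (isThFun f) →
                 All (λ τ → T (isThSort τ)) ss × T (isThSort σ)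
    BoolS     : Sort
    BoolS-th  : T (isThSort BoolS)
    andF      : Fun (BoolS ∷ BoolS ∷ []) BoolS
    andF-th   : T (isThFun andF)
    V         : Set
    _≟V_      : DecidableEquality V
    vsort     : V → Sort

module Terms (S : Signature) where
  open Signature S

  infixr 5 _∷ᵃ_
  mutual
    data Term : Sort → Set where
      var : (x : V) → Term (vsort x)
      app : ∀ {ss σ} → Fun ss σ → Args ss → Term σ

    data Args : List Sort → Set where
      []ᵃ  : Args []
      _∷ᵃ_ : ∀ {σ ss} → Term σ → Args ss → Args (σ ∷ ss)

  infix 4 _∈V_ _∈VA_
  mutual
    data _∈V_ (x : V) : ∀ {σ} → Term σ → Set where
      here   : x ∈V var x
      inArgs : ∀ {ss σ} {f : Fun ss σ} {ts : Args ss} → x ∈VA ts → x ∈V app f ts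

    data _∈VA_ (x : V) : ∀ {ss} → Args ss → Set where
      inHead : ∀ {σ ss} {t : Term σ} {ts : Args ss} → x ∈V t → x ∈VA (t ∷ᵃ ts)
      inTail : ∀ {σ ss} {t : Term σ} {ts : Args ss} → x ∈VA ts → x ∈VA (t ∷ᵃ ts)

  mutual
    count : ∀ {σ} → V → Term σ → ℕ
    count x (var y)    = if does (x ≟V y) then 1 else 0
    count x (app f ts) = countA x ts

    countA : ∀ {ss} → V → Args ss → ℕ
    countA x []ᵃ        = 0
    countA x (t ∷ᵃ ts)  = count x t + countA x ts

  Linear : ∀ {σ} → Term σ → Set
  Linear t = ∀ x → count x t ≤ 1

  mutual
    data ThTerm : ∀ {σ} → Term σ → Set where
      var : ∀ x → ThTerm (var x)
      app : ∀ {ss σ} {f : Fun ss σ} {ts : Args ss} → T (isThFun f) → ThArgs ts → ThTerm (app f ts)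

    data ThArgs : ∀ {ss} → Args ss → Set where
      []ᵃ  : ThArgs []ᵃ
      _∷ᵃ_ : ∀ {σ ss} {t : Term σ} {ts : Args ss} → ThTerm t → ThArgs ts → ThArgs (t ∷ᵃ ts)

  LogicalConstraint : Term BoolS → Set
  LogicalConstraint φ = ThTerm φ

  _∧ᵗ_ : Term BoolS → Term BoolS → Term BoolS
  φ ∧ᵗ ψ = app andF (φ ∷ᵃ ψ ∷ᵃ []ᵃ)

  Subst : Set
  Subst = (x : V) → Term (vsort x)

  mutual
    _⟪_⟫ : ∀ {σ} → Term σ → Subst → Term σ
    var x ⟪ θ ⟫    = θ x
    app f ts ⟪ θ ⟫ = app f (ts ⟪ θ ⟫ᵃ)

    _⟪_⟫ᵃ : ∀ {ss} → Args ss → Subst → Args ss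
    []ᵃ ⟪ θ ⟫ᵃ        = []ᵃ
    (t ∷ᵃ ts) ⟪ θ ⟫ᵃ  = (t ⟪ θ ⟫) ∷ᵃ (ts ⟪ θ ⟫ᵃ)

  -- positions (argument indices counted from 0)
  Pos : Set
  Pos = List ℕ

  mutual
    _∣_ : ∀ {σ} → Term σ → Pos → Maybe (Σ Sort Term)
    t ∣ []               = just (_ , t)
    var x ∣ (i ∷ p)      = nothing
    app f ts ∣ (i ∷ p)   = argAt ts i p

    argAt : ∀ {ss} → Args ss → ℕ → Pos → Maybe (Σ Sort Term)
    argAt []ᵃ i p              = nothing
    argAt (t ∷ᵃ ts) zero p     = t ∣ p
    argAt (t ∷ᵃ ts) (suc i) p  = argAt ts i p

  -- replace s u p ≡ just t  iff  p ∈ Pos(s), sorts match and t = s[u]_p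
  mutual
    replace : ∀ {σ} → Term σ → Σ Sort Term → Pos → Maybe (Term σ)
    replace {σ} t (τ , u) [] with τ ≟S σ
    ... | yes refl = just u
    ... | no _     = nothing
    replace (var x) u (i ∷ p)    = nothing
    replace (app f ts) u (i ∷ p) = Maybe.map (app f) (replaceA ts u i p)

    replaceA : ∀ {ss} → Args ss → Σ Sort Term → ℕ → Pos → Maybe (Args ss)
    replaceA []ᵃ u i p              = nothing
    replaceA (t ∷ᵃ ts) u zero p     = Maybe.map (_∷ᵃ ts) (replace t u p)
    replaceA (t ∷ᵃ ts) u (suc i) p  = Maybe.map (t ∷ᵃ_) (replaceA ts u i p)

record Model (S : Signature) : Set₁ where
  open Signature S
  field
    ⟦_⟧       : Sort → Set      -- only meaningful on theory sorts
    nonempty  : ∀ σ → T (isThSort σ) → ⟦ σ ⟧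
    interp    : ∀ {ss σ} (f : Fun ss σ) → T (isThFun f) → All ⟦_⟧ ss → ⟦ σ ⟧
    boolEq    : ⟦ BoolS ⟧ ≡ Bool
    and-interp : ∀ a b → subst (λ A → A) boolEq (interp andF andF-th (a ∷ b ∷ []))
                         ≡ (subst (λ A → A) boolEq a ∧ subst (λ A → A) boolEq b)
    -- every element of every interpreted sort is a constant theory symbol (a value)
    valSym        : ∀ σ → T (isThSort σ) → ⟦ σ ⟧ → Fun [] σ
    valSym-th     : ∀ σ th v → T (isThFun (valSym σ th v))
    valSym-interp : ∀ σ th v → interp (valSym σ th v) (valSym-th σ th v) [] ≡ v

module Rewriting (S : Signature) (M : Model S) where
  open Signature S
  open Terms S
  open Model M

  private
    decT : (b : Bool) → Maybe (T b)
    decT true  = just tt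
    decT false = nothing

  Valuation : Set
  Valuation = (x : V) → T (isThSort (vsort x)) → ⟦ vsort x ⟧

  mutual
    eval : ∀ {σ} → Valuation → Term σ → Maybe ⟦ σ ⟧
    eval ξ (var x)    = Maybe.map (ξ x) (decT (isThSort (vsort x)))
    eval ξ (app f ts) = decT (isThFun f) >>= λ th → evalA ξ ts >>= λ vs → just (interp f th vs)

    evalA : ∀ {ss} → Valuation → Args ss → Maybe (All ⟦_⟧ ss)
    evalA ξ []ᵃ        = just []
    evalA ξ (t ∷ᵃ ts)  = eval ξ t >>= λ v → evalA ξ ts >>= λ vs → just (v ∷ vs)

  Holds : Valuation → Term BoolS → Set
  Holds ξ φ = Maybe.map (subst (λ A → A) boolEq) (eval ξ φ) ≡ just true

  data IsValue : ∀ {σ} → Term σ → Set where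
    isVal : ∀ σ th v → IsValue (app (valSym σ th v) []ᵃ)

  data IsVarIn (X : Pred V 0ℓ) : ∀ {σ} → Term σ → Set where
    isVar : ∀ {y} → X y → IsVarIn X (var y)

  record ExCon : Set where
    constructor ∃ᶜ[_]_
    field
      bound : List V
      body  : Term BoolS
  open ExCon public

  WFExCon : ExCon → Set
  WFExCon e = LogicalConstraint (body e) × (∀ x → x ∈ bound e → x ∈V body e)

  FVar : ExCon → Pred V 0ℓ
  FVar e x = x ∈V body e × ¬ (x ∈ bound e)

  ValuesFor : List V → Subst → Set
  ValuesFor xs θ = (∀ x → x ∈ xs → IsValue (θ x)) × (∀ x → ¬ (x ∈ xs) → θ x ≡ var x)

  HoldsEx : Valuation → ExCon → Set
  HoldsEx ξ e = ∃[ θ ] (ValuesFor (bound e) θ × Holds ξ (body e ⟪ θ ⟫))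

  record CTerm (σ : Sort) : Set₁ where
    constructor Π_∙_[_]
    field
      X   : Pred V 0ℓ
      s   : Term σ
      con : ExCon
  open CTerm public

  WFCTerm : ∀ {σ} → CTerm σ → Set
  WFCTerm c = WFExCon (con c)
            × (∀ x → FVar (con c) x → X c x)
            × (∀ x → X c x → x ∈V s c)
            × (∀ x → x ∈ bound (con c) → ¬ (x ∈V s c))

  Satisfiable : ∀ {σ} → CTerm σ → Set
  Satisfiable c = ∃[ ξ ] HoldsEx ξ (con c)

  record Rule : Set₁ where
    field
      τ  : Sort
      Z  : Pred V 0ℓ
      ℓ  : Term τ
      r  : Term τ
      π  : Term BoolS
  open Rule public

  VarRule : Rule → Pred V 0ℓ
  VarRule ρ x = x ∈V ℓ ρ ⊎ x ∈V r ρ ⊎ x ∈V π ρ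

  ExVar : Rule → Pred V 0ℓ
  ExVar ρ x = x ∈V r ρ × ¬ (x ∈V ℓ ρ)

  WFRule : Rule → Set
  WFRule ρ = LogicalConstraint (π ρ)
           × (∀ x → (ExVar ρ x ⊎ x ∈V π ρ) → Z ρ x)
           × (∀ x → Z ρ x → VarRule ρ x)

  LeftLinear : Rule → Set
  LeftLinear ρ = Linear (ℓ ρ)

  RuleDisjoint : ∀ {σ} → Rule → CTerm σ → Set
  RuleDisjoint ρ c = ∀ x → VarRule ρ x → ¬ (x ∈V s c) × ¬ (x ∈V body (con c))

  -- the most general rewrite step  c →_ρ c'  (its side conditions on c and ρ,
  -- satisfiability, left-linearity and disjointness, are hypotheses where used)
  record Step {σ} (c : CTerm σ) (ρ : Rule) (c' : CTerm σ) : Set₁ where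
    field
      p       : Pos
      γ       : Subst
      dom     : ∀ x → (γ x ≢ var x) ⇔ (x ∈V ℓ ρ)
      match   : s c ∣ p ≡ just (τ ρ , ℓ ρ ⟪ γ ⟫)
      valOrX  : ∀ x → x ∈V ℓ ρ → Z ρ x → IsValue (γ x) ⊎ IsVarIn (X c) (γ x)
      zs      : List V
      zs-spec : ∀ z → (z ∈ zs) ⇔ (z ∈V π ρ × ¬ (z ∈V ℓ ρ))
      entail  : ∀ ξ → HoldsEx ξ (con c) → HoldsEx ξ (∃ᶜ[ zs ] (π ρ ⟪ γ ⟫))
      t-def   : replace (s c) (τ ρ , r ρ ⟪ γ ⟫) p ≡ just (s c')
      ψ-def   : body (con c') ≡ (body (con c) ∧ᵗ (π ρ ⟪ γ ⟫))
      ys-spec : ∀ y → (y ∈ bound (con c')) ⇔ (y ∈V body (con c') × ¬ (y ∈V s c'))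
      Y-spec  : ∀ y → X c' y ⇔ (ExVar ρ y ⊎ (X c y × y ∈V s c'))

{-# OPTIONS --safe #-}
-- A free variable y of ψ = φ ∧ πγ lies in t, as the bound variables of the result are
-- exactly those of ψ outside t.  Every variable of t = s[rγ]_p is a variable of s or an
-- extra variable of ρ, because a variable x of r that is also in ℓ contributes the
-- variables of γ(x) ⊆ Var(ℓγ) ⊆ Var(s), while γ fixes the variables outside ℓ.  So if y
-- is a variable of φ, it is free in ∃x⃗.φ (hence in X) or is bound there and then cannot
-- occur in s, making it extra in ρ.  If y occurs in γ(x) for a variable x of π, either
-- x ∈ Var(ℓ) ∩ Z, so γ(x) is a value or a variable of X, or γ fixes x = y, a variable of
-- ρ, which by disjointness is not in s and hence again extra in ρ.
module Submission where

open import Data.Empty using (⊥-elim)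
import Data.List.Membership.DecPropositional as DecMembership
open import Data.List using ([]; _∷_)
open import Data.Maybe using (Maybe; just)
import Data.Maybe as Maybe
open import Data.Nat using (zero; suc)
open import Data.Product using (_×_; _,_; proj₁; ∃-syntax)
open import Data.Sum using (_⊎_; inj₁; inj₂)
import Data.Sum as Sum
open import Function.Base using (_∘_; id)
open import Function.Bundles using (Equivalence)
open import Relation.Nullary using (¬_; Dec; yes; no)
open import Relation.Binary.PropositionalEquality using (_≡_; refl; subst)
open import Defs

map-just⁻ : ∀ {A B : Set} {f : A → B} (ma : Maybe A) {b : B} →
            Maybe.map f ma ≡ just b → ∃[ a ] (ma ≡ just a × f a ≡ b)
map-just⁻ (just a) refl = a , refl , refl

module TermVariables (S : Signature) where
  open Signature S
  open Terms S

  infix 4 _∈V?_ _∈VA?_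

  mutual
    _∈V?_ : ∀ y {σ} (t : Term σ) → Dec (y ∈V t)
    y ∈V? var x with y ≟V x
    ... | yes refl = yes here
    ... | no y≢x   = no λ { here → y≢x refl }
    y ∈V? app f ts with y ∈VA? ts
    ... | yes y∈ts = yes (inArgs y∈ts)
    ... | no y∉ts  = no λ { (inArgs y∈ts) → y∉ts y∈ts }

    _∈VA?_ : ∀ y {ss} (ts : Args ss) → Dec (y ∈VA ts)
    y ∈VA? []ᵃ = no λ ()
    y ∈VA? (t ∷ᵃ ts) with y ∈V? t | y ∈VA? ts
    ... | yes y∈t | _        = yes (inHead y∈t)
    ... | no _    | yes y∈ts = yes (inTail y∈ts)
    ... | no y∉t  | no y∉ts  = no λ { (inHead y∈t) → y∉t y∈t ; (inTail y∈ts) → y∉ts y∈ts }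

  ∈V-var⁻ : ∀ {y x} → y ∈V var x → y ≡ x
  ∈V-var⁻ here = refl

  ∈V-∧ᵗ⁻ : ∀ {y φ ψ} → y ∈V φ ∧ᵗ ψ → y ∈V φ ⊎ y ∈V ψ
  ∈V-∧ᵗ⁻ (inArgs (inHead y∈φ))          = inj₁ y∈φ
  ∈V-∧ᵗ⁻ (inArgs (inTail (inHead y∈ψ))) = inj₂ y∈ψ

  mutual
    ∈V-subterm : ∀ {y σ τ} (s : Term σ) (p : Pos) {u : Term τ} →
                 s ∣ p ≡ just (τ , u) → y ∈V u → y ∈V s
    ∈V-subterm s          []      refl y∈u = y∈u
    ∈V-subterm (app f ts) (i ∷ p) eq   y∈u = inArgs (∈VA-argAt ts i p eq y∈u)

    ∈VA-argAt : ∀ {y ss τ} (ts : Args ss) i (p : Pos) {u : Term τ} →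
                argAt ts i p ≡ just (τ , u) → y ∈V u → y ∈VA ts
    ∈VA-argAt (t ∷ᵃ ts) zero    p eq y∈u = inHead (∈V-subterm t p eq y∈u)
    ∈VA-argAt (t ∷ᵃ ts) (suc i) p eq y∈u = inTail (∈VA-argAt ts i p eq y∈u)

  mutual
    ∈V-replace⁻ : ∀ {y σ τ} (s : Term σ) (p : Pos) {u : Term τ} {t : Term σ} →
                  replace s (τ , u) p ≡ just t → y ∈V t → y ∈V s ⊎ y ∈V u
    ∈V-replace⁻ {σ = σ} {τ} s [] eq y∈t with τ ≟S σ | eq
    ... | yes refl | refl = inj₂ y∈t
    ∈V-replace⁻ (app f ts) (i ∷ p) {u} eq y∈t with map-just⁻ (replaceA ts (_ , u) i p) eq
    ∈V-replace⁻ (app f ts) (i ∷ p) eq (inArgs y∈ts′) | _ , eq′ , refl =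
      Sum.map₁ inArgs (∈VA-replaceA⁻ ts i p eq′ y∈ts′)

    ∈VA-replaceA⁻ : ∀ {y ss τ} (ts : Args ss) i (p : Pos) {u : Term τ} {ts′ : Args ss} →
                    replaceA ts (τ , u) i p ≡ just ts′ → y ∈VA ts′ → y ∈VA ts ⊎ y ∈V u
    ∈VA-replaceA⁻ (t ∷ᵃ ts) zero p {u} eq y∈ts′ with map-just⁻ (replace t (_ , u) p) eq
    ∈VA-replaceA⁻ (t ∷ᵃ ts) zero p eq (inHead y∈t′) | _ , eq′ , refl =
      Sum.map₁ inHead (∈V-replace⁻ t p eq′ y∈t′)
    ∈VA-replaceA⁻ (t ∷ᵃ ts) zero p eq (inTail y∈ts) | _ , _ , refl = inj₁ (inTail y∈ts)
    ∈VA-replaceA⁻ (t ∷ᵃ ts) (suc i) p {u} eq y∈ts′ with map-just⁻ (replaceA ts (_ , u) i p) eq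
    ∈VA-replaceA⁻ (t ∷ᵃ ts) (suc i) p eq (inHead y∈t) | _ , _ , refl = inj₁ (inHead y∈t)
    ∈VA-replaceA⁻ (t ∷ᵃ ts) (suc i) p eq (inTail y∈ts″) | _ , eq′ , refl =
      Sum.map₁ inTail (∈VA-replaceA⁻ ts i p eq′ y∈ts″)

  mutual
    ∈V-⟪⟫⁺ : ∀ {y x σ} (γ : Subst) (t : Term σ) → x ∈V t → y ∈V γ x → y ∈V t ⟪ γ ⟫
    ∈V-⟪⟫⁺ γ (var x)    here          y∈γx = y∈γx
    ∈V-⟪⟫⁺ γ (app f ts) (inArgs x∈ts) y∈γx = inArgs (∈VA-⟪⟫ᵃ⁺ γ ts x∈ts y∈γx)

    ∈VA-⟪⟫ᵃ⁺ : ∀ {y x ss} (γ : Subst) (ts : Args ss) → x ∈VA ts → y ∈V γ x → y ∈VA ts ⟪ γ ⟫ᵃ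
    ∈VA-⟪⟫ᵃ⁺ γ (t ∷ᵃ ts) (inHead x∈t)  y∈γx = inHead (∈V-⟪⟫⁺ γ t x∈t y∈γx)
    ∈VA-⟪⟫ᵃ⁺ γ (t ∷ᵃ ts) (inTail x∈ts) y∈γx = inTail (∈VA-⟪⟫ᵃ⁺ γ ts x∈ts y∈γx)

  mutual
    ∈V-⟪⟫⁻ : ∀ {y σ} (γ : Subst) (t : Term σ) → y ∈V t ⟪ γ ⟫ → ∃[ x ] (x ∈V t × y ∈V γ x)
    ∈V-⟪⟫⁻ γ (var x)    y∈γx = x , here , y∈γx
    ∈V-⟪⟫⁻ γ (app f ts) (inArgs y∈tsγ) with ∈VA-⟪⟫ᵃ⁻ γ ts y∈tsγ
    ... | x , x∈ts , y∈γx = x , inArgs x∈ts , y∈γx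

    ∈VA-⟪⟫ᵃ⁻ : ∀ {y ss} (γ : Subst) (ts : Args ss) → y ∈VA ts ⟪ γ ⟫ᵃ →
               ∃[ x ] (x ∈VA ts × y ∈V γ x)
    ∈VA-⟪⟫ᵃ⁻ γ (t ∷ᵃ ts) (inHead y∈tγ) with ∈V-⟪⟫⁻ γ t y∈tγ
    ... | x , x∈t , y∈γx = x , inHead x∈t , y∈γx
    ∈VA-⟪⟫ᵃ⁻ γ (t ∷ᵃ ts) (inTail y∈tsγ) with ∈VA-⟪⟫ᵃ⁻ γ ts y∈tsγ
    ... | x , x∈ts , y∈γx = x , inTail x∈ts , y∈γx

module StepProperties (S : Signature) (M : Model S) where
  open Signature S
  open Terms S
  open Rewriting S M
  open TermVariables S
  open Equivalence using (to; from)

  ∉V-IsValue : ∀ {y σ} {u : Term σ} → IsValue u → ¬ (y ∈V u)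
  ∉V-IsValue (isVal _ _ _) (inArgs ())

  IsVarIn⇒∈ : ∀ {y σ Y} {u : Term σ} → IsVarIn Y u → y ∈V u → Y y
  IsVarIn⇒∈ (isVar Yx) here = Yx

  module _ {σ} {c c′ : CTerm σ} {ρ : Rule} (step : Step c ρ c′) where
    open Step step

    γ-fixes-∉ℓ : ∀ {x y} → ¬ (x ∈V ℓ ρ) → y ∈V γ x → y ≡ x
    γ-fixes-∉ℓ {x} {y} x∉ℓ y∈γx with y ≟V x
    ... | yes y≡x = y≡x
    ... | no y≢x  = ⊥-elim (x∉ℓ (to (dom x) λ γx≡x → y≢x (∈V-var⁻ (subst (y ∈V_) γx≡x y∈γx))))

    ∈V-result⁻ : ∀ {y} → y ∈V s c′ → y ∈V s c ⊎ ExVar ρ y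
    ∈V-result⁻ {y} y∈t with ∈V-replace⁻ (s c) p t-def y∈t
    ... | inj₁ y∈s  = inj₁ y∈s
    ... | inj₂ y∈rγ with ∈V-⟪⟫⁻ γ (r ρ) y∈rγ
    ... | x , x∈r , y∈γx with x ∈V? ℓ ρ
    ... | yes x∈ℓ = inj₁ (∈V-subterm (s c) p match (∈V-⟪⟫⁺ γ (ℓ ρ) x∈ℓ y∈γx))
    ... | no x∉ℓ with γ-fixes-∉ℓ x∉ℓ y∈γx
    ... | refl = inj₂ (x∈r , x∉ℓ)

    ∉V-s⇒ExVar : ∀ {y} → y ∈V s c′ → ¬ (y ∈V s c) → ExVar ρ y
    ∉V-s⇒ExVar y∈t y∉s = Sum.[ ⊥-elim ∘ y∉s , id ] (∈V-result⁻ y∈t)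

    ∈V-γ-Z⇒X : ∀ {x y} → x ∈V ℓ ρ → Z ρ x → y ∈V γ x → X c y
    ∈V-γ-Z⇒X {x} x∈ℓ x∈Z y∈γx with valOrX x x∈ℓ x∈Z
    ... | inj₁ value = ⊥-elim (∉V-IsValue value y∈γx)
    ... | inj₂ var∈X = IsVarIn⇒∈ var∈X y∈γx

    ∈V-πγ⁻ : WFRule ρ → ∀ {y} → y ∈V π ρ ⟪ γ ⟫ → X c y ⊎ y ∈V π ρ
    ∈V-πγ⁻ (_ , ExVar∪Var-π⊆Z , _) y∈πγ with ∈V-⟪⟫⁻ γ (π ρ) y∈πγ
    ... | x , x∈π , y∈γx with x ∈V? ℓ ρ
    ... | yes x∈ℓ = inj₁ (∈V-γ-Z⇒X x∈ℓ (ExVar∪Var-π⊆Z x (inj₂ x∈π)) y∈γx)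
    ... | no x∉ℓ with γ-fixes-∉ℓ x∉ℓ y∈γx
    ... | refl = inj₂ x∈π

    FVar-result⇒∈V : ∀ {y} → FVar (con c′) y → y ∈V s c′
    FVar-result⇒∈V {y} (y∈ψ , y∉ys) with y ∈V? s c′
    ... | yes y∈t = y∈t
    ... | no y∉t  = ⊥-elim (y∉ys (from (ys-spec y) (y∈ψ , y∉t)))

mainTheorem9 : (S : Signature) (M : Model S) →
    let open Signature S
        open Terms S
        open Rewriting S M
    in
    ∀ {σ} (c c' : CTerm σ) (ρ : Rule) →
    WFCTerm c → Satisfiable c → WFRule ρ → LeftLinear ρ → RuleDisjoint ρ c →
    Step c ρ c' →
    ∀ y → FVar (con c') y → ExVar ρ y ⊎ (X c y × y ∈V s c')
mainTheorem9 S M c c' ρ (_ , FVar⊆X , _ , bound∉s) _ wfρ _ disjoint step y y∈FVar =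
  Sum.map₂ (_, y∈t) fromψ
  where
    open Signature S
    open Terms S
    open Rewriting S M
    open TermVariables S
    open StepProperties S M
    open DecMembership _≟V_ using (_∈?_)
    open Step step using (ψ-def)

    y∈t : y ∈V s c'
    y∈t = FVar-result⇒∈V step y∈FVar

    fromψ : ExVar ρ y ⊎ X c y
    fromψ with ∈V-∧ᵗ⁻ (subst (y ∈V_) ψ-def (proj₁ y∈FVar))
    ... | inj₁ y∈φ with y ∈? bound (con c)
    ...   | yes y∈xs = inj₁ (∉V-s⇒ExVar step y∈t (bound∉s y y∈xs))
    ...   | no y∉xs  = inj₂ (FVar⊆X y (y∈φ , y∉xs))
    fromψ | inj₂ y∈πγ with ∈V-πγ⁻ step wfρ y∈πγ
    ... | inj₁ y∈X = inj₂ y∈X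
    ... | inj₂ y∈π = inj₁ (∉V-s⇒ExVar step y∈t (proj₁ (disjoint y (inj₂ (inj₂ y∈π)))))
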